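{- Let $k$ be a positive integer and let $G$ be a triangle-free graph with $e(G)>\lfloor\frac{k^2}{4}\rfloor$. Then $G$ contains a forest with at least $k$ edges. Moreover, the bound is sharp: the complete bipartite graph $K_{\lfloor k/2\rfloor,\lceil k/2\rceil}$ is triangle-free, has $\lfloor\frac{k^2}{4}\rfloor$ edges, and contains no forest with $k$ edges. -}

module Defs where

open import Data.Bool using (Bool; true; false; _∧_; _xor_)
open import Data.Bool.Properties using (xor-same)
open import Data.Nat using (ℕ; zero; suc; _+_; _<ᵇ_)
open import Data.Fin using (Fin; zero; suc; toℕ; inject₁; fromℕ)
open import Data.List using (List; length; filter; map; concatMap; allFin)
open import Data.Product using (Σ; _×_; _,_; proj₁; proj₂; ∃)
open import Relation.Nullary using (¬_)
open import Relation.Binary.PropositionalEquality using (_≡_; refl)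
open import Function.Definitions using (Injective)

record Graph (n : ℕ) : Set where
  field
    adj    : Fin n → Fin n → Bool
    sym    : ∀ i j → adj i j ≡ adj j i
    irrefl : ∀ i → adj i i ≡ false
open Graph public

edges : ∀ {n} → Graph n → List (Fin n × Fin n)
edges {n} G =
  filter (λ p → T? ((toℕ (proj₁ p) <ᵇ toℕ (proj₂ p)) ∧ adj G (proj₁ p) (proj₂ p)))
         (concatMap (λ i → map (λ j → i , j) (allFin n)) (allFin n))
  where
  open import Data.Bool using (T)
  open import Data.Bool.Properties using () renaming (T? to T?)

e : ∀ {n} → Graph n → ℕ
e G = length (edges G)

-- H is a subgraph of G (on the same vertex set; isolated vertices are harmless)
_⊆G_ : ∀ {n} → Graph n → Graph n → Set
H ⊆G G = ∀ i j → adj H i j ≡ true → adj G i j ≡ true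

-- Triangle-free: no three mutually adjacent vertices
-- (distinctness is automatic by irreflexivity).
TriangleFree : ∀ {n} → Graph n → Set
TriangleFree G = ¬ (Σ _ λ a → Σ _ λ b → Σ _ λ c →
  adj G a b ≡ true × adj G b c ≡ true × adj G a c ≡ true)

record Cycle {n} (G : Graph n) : Set where
  field
    m     : ℕ
    v     : Fin (suc (suc (suc m))) → Fin n
    inj   : Injective _≡_ _≡_ v
    step  : ∀ (i : Fin (suc (suc m))) → adj G (v (inject₁ i)) (v (suc i)) ≡ true
    close : adj G (v (fromℕ (suc (suc m)))) (v zero) ≡ true

Forest : ∀ {n} → Graph n → Set
Forest G = ¬ Cycle G

private
  xor-comm : ∀ x y → x xor y ≡ y xor x
  xor-comm true true = refl
  xor-comm true false = refl
  xor-comm false true = refl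
  xor-comm false false = refl

K : (a b : ℕ) → Graph (a + b)
K a b = record
  { adj    = λ i j → (toℕ i <ᵇ a) xor (toℕ j <ᵇ a)
  ; sym    = λ i j → xor-comm (toℕ i <ᵇ a) (toℕ j <ᵇ a)
  ; irrefl = λ i → xor-same (toℕ i <ᵇ a)
  }

module Submission where

open import Defs renaming (sym to adj-sym; irrefl to adj-irrefl)
open import Data.Bool using (Bool; true; false; T; _∧_; _∨_; not; if_then_else_; _xor_)
open import Data.Bool.Properties using (∧-identityʳ; ∧-zeroʳ; ∨-comm; T?)
import Data.Bool.Properties as Bool
open import Data.Empty using (⊥; ⊥-elim)
open import Data.Fin using (Fin; zero; suc; toℕ; inject₁; fromℕ; _≟_)
open import Data.Fin.Properties using (any?; pigeonhole; toℕ-injective; toℕ-inject₁; toℕ-fromℕ; toℕ<n)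
open import Data.Fin.Relation.Unary.Top using (view; ‵fromℕ; ‵inject₁)
open import Data.List using (List; length; filter; map; concat; tabulate; allFin; _++_)
open import Data.List.Properties using (filter-++; length-++; map-tabulate)
open import Data.List.Membership.Propositional.Properties using (∈-allFin; ∈-filter⁺)
import Data.List.Relation.Unary.All as All
open import Data.List.Relation.Unary.All.Properties using (all-filter)
open import Data.Maybe using (Maybe; just; nothing; maybe; is-just)
open import Data.Maybe.Properties using (just-injective)
open import Data.Nat
  using (ℕ; zero; suc; _+_; _*_; _∸_; _/_; _≤_; _<_; _<ᵇ_; z≤n; s≤s; s≤s⁻¹; z<s; pred; ⌊_/2⌋; ⌈_/2⌉; >-nonZero)
open import Data.Nat.DivMod using (m*n/n≡m; /-monoˡ-≤; +-distrib-/-∣ʳ)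
open import Data.Nat.Divisibility using (divides)
open import Data.Nat.Induction using (<-rec)
open import Data.Nat.Properties hiding (_≟_)
import Data.Nat.Properties as ℕ
import Data.List.Extrema ℕ.≤-totalOrder as Extrema
open import Algebra.Properties.Semiring.Sum +-*-semiring
  using (sum-syntax; sum-cong-≗; sum-replicate-zero; ∑-distrib-+; ∑-comm; *-distribˡ-sum; *-distribʳ-sum)
open import Data.Nat.Tactic.RingSolver using (solve-∀)
open import Data.Product using (Σ; ∃; ∃₂; _×_; _,_; proj₁; proj₂)
open import Function using (_∘_; id)
open import Relation.Binary.Definitions using (tri<; tri≈; tri>)
open import Relation.Binary.PropositionalEquality
  using (_≡_; _≢_; refl; sym; trans; cong; cong₂; subst; subst₂; module ≡-Reasoning)
open import Relation.Nullary using (¬_; Dec; yes; no; does; contradiction; _×-dec_; ¬?)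
open import Relation.Nullary.Decidable using (dec-true; dec-false; decidable-stable)
open import Relation.Unary using (Pred; Decidable)

-- The first part is proved by a greedy induction on the vertex set S, with the invariant
-- 4 e(G[S]) ≤ (|F| + 1)² for a forest F in G[S]. Remove a vertex u of least positive
-- degree d from S and build F′ in G[S − u]. If 4d ≤ 2|F′| + 3, hanging u below one of its
-- neighbours w keeps the invariant. Otherwise the double star at the edge uw (u joined to
-- its neighbours, w to its other neighbours; disjoint as G is triangle-free) is itself a
-- forest with d + deg w − 1 ≥ 2d − 1 edges, which suffices because |F′| ≤ 2d − 2.
-- For sharpness, K_{⌊k/2⌋,⌈k/2⌉} has ⌊k²/4⌋ edges, and a forest on k vertices has at most
-- k − 1: if every vertex has degree ≥ 2, a non-backtracking walk closes a cycle, so there is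
-- always a vertex of degree ≤ 1 to remove.

-- Counting over finite sets

𝟙 : Bool → ℕ
𝟙 false = 0
𝟙 true  = 1

𝟙≤1 : ∀ b → 𝟙 b ≤ 1
𝟙≤1 false = z≤n
𝟙≤1 true  = s≤s z≤n

𝟙-∧ : ∀ a b → 𝟙 (a ∧ b) ≡ 𝟙 a * 𝟙 b
𝟙-∧ false b = refl
𝟙-∧ true  b = sym (+-identityʳ (𝟙 b))

𝟙-∨ : ∀ {a b} → ¬ (a ≡ true × b ≡ true) → 𝟙 (a ∨ b) ≡ 𝟙 a + 𝟙 b
𝟙-∨ {false} {b}     _     = refl
𝟙-∨ {true}  {false} _     = refl
𝟙-∨ {true}  {true}  ¬both = contradiction (refl , refl) ¬both

𝟙-xor : ∀ a b → 𝟙 (a xor b) ≡ 𝟙 (a ∧ not b) + 𝟙 (b ∧ not a)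
𝟙-xor false false = refl
𝟙-xor false true  = refl
𝟙-xor true  false = refl
𝟙-xor true  true  = refl

∧-true : ∀ {a b} → a ∧ b ≡ true → a ≡ true × b ≡ true
∧-true {true} {true} _ = refl , refl

xor-triangle : ∀ a b c → a xor b ≡ true → b xor c ≡ true → a xor c ≡ false
xor-triangle false false c     ()
xor-triangle false true  false _ _ = refl
xor-triangle false true  true  _ ()
xor-triangle true  false false _ ()
xor-triangle true  false true  _ _ = refl
xor-triangle true  true  c     ()

∑-mono-≤ : ∀ {n} {f g : Fin n → ℕ} → (∀ i → f i ≤ g i) → ∑[ i < n ] f i ≤ ∑[ i < n ] g i
∑-mono-≤ {zero}  _   = z≤n
∑-mono-≤ {suc n} f≤g = +-mono-≤ (f≤g zero) (∑-mono-≤ (f≤g ∘ suc))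

∑-zero : ∀ {n} {f : Fin n → ℕ} → (∀ i → f i ≡ 0) → ∑[ i < n ] f i ≡ 0
∑-zero {n} f≡0 = trans (sum-cong-≗ f≡0) (sum-replicate-zero n)

∑-δ : ∀ {n} (u : Fin n) (g : Fin n → ℕ) → ∑[ i < n ] (𝟙 (does (u ≟ i)) * g i) ≡ g u
∑-δ {suc n} zero    g = trans (cong₂ _+_ (+-identityʳ (g zero)) (∑-zero {n} λ _ → refl)) (+-identityʳ (g zero))
∑-δ {suc n} (suc u) g = ∑-δ u (g ∘ suc)

∑-δ-count : ∀ {n} (u : Fin n) → ∑[ i < n ] 𝟙 (does (u ≟ i)) ≡ 1
∑-δ-count {n} u = trans (sum-cong-≗ {n} λ i → sym (*-identityʳ _)) (∑-δ u λ _ → 1)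

∑∑-symmetrise : ∀ {n} (A o : Fin n → Fin n → ℕ) → (∀ x y → A x y ≡ o x y + o y x) →
  ∑[ x < n ] ∑[ y < n ] A x y ≡ 2 * ∑[ x < n ] ∑[ y < n ] o x y
∑∑-symmetrise {n} A o A≡o+oᵀ = begin
  ∑[ x < n ] ∑[ y < n ] A x y
    ≡⟨ sum-cong-≗ {n} (λ x → trans (sum-cong-≗ {n} (A≡o+oᵀ x)) (∑-distrib-+ {n} _ _)) ⟩
  ∑[ x < n ] (∑[ y < n ] o x y + ∑[ y < n ] o y x)
    ≡⟨ ∑-distrib-+ {n} _ _ ⟩
  ∑o + ∑[ x < n ] ∑[ y < n ] o y x
    ≡⟨ cong (∑o +_) (trans (∑-comm (λ x y → o y x)) (sym (+-identityʳ ∑o))) ⟩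
  2 * ∑o ∎
  where
  open ≡-Reasoning
  ∑o : ℕ
  ∑o = ∑[ x < n ] ∑[ y < n ] o x y

module _ {a p} {A : Set a} {P : Pred A p} (P? : Decidable P) where
  open ≡-Reasoning

  length-filter-tabulate : ∀ {n} (f : Fin n → A) →
    length (filter P? (tabulate f)) ≡ ∑[ i < n ] 𝟙 (does (P? (f i)))
  length-filter-tabulate {zero}  f = refl
  length-filter-tabulate {suc n} f with does (P? (f zero))
  ... | false = length-filter-tabulate (f ∘ suc)
  ... | true  = cong suc (length-filter-tabulate (f ∘ suc))

  length-filter-concat-tabulate : ∀ {n} (xss : Fin n → List A) →
    length (filter P? (concat (tabulate xss))) ≡ ∑[ i < n ] length (filter P? (xss i))
  length-filter-concat-tabulate {zero}  xss = refl
  length-filter-concat-tabulate {suc n} xss = begin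
    length (filter P? (xss zero ++ rest))
      ≡⟨ cong length (filter-++ P? (xss zero) rest) ⟩
    length (filter P? (xss zero) ++ filter P? rest)
      ≡⟨ length-++ (filter P? (xss zero)) ⟩
    length (filter P? (xss zero)) + length (filter P? rest)
      ≡⟨ cong (length (filter P? (xss zero)) +_) (length-filter-concat-tabulate (xss ∘ suc)) ⟩
    length (filter P? (xss zero)) + ∑[ i < n ] length (filter P? (xss (suc i))) ∎
    where
    rest : List A
    rest = concat (tabulate (xss ∘ suc))

least-witness : ∀ {p} {P : Pred ℕ p} → Decidable P → ∀ {m} → P m →
  ∃ λ j → P j × (∀ {i} → i < j → ¬ P i)
least-witness {p} {P} P? {m} = <-rec Least step m
  where
  Least : ℕ → Set p
  Least m = P m → ∃ λ j → P j × (∀ {i} → i < j → ¬ P i)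
  step : ∀ m → (∀ {i} → i < m → Least i) → Least m
  step m smaller Pm with anyUpTo? P? m
  ... | yes (i , i<m , Pi) = smaller i<m Pi
  ... | no none            = m , Pm , λ i<m Pi → none (_ , i<m , Pi)

-- Vertex sets and degrees in induced subgraphs

VertexSet : ℕ → Set
VertexSet n = Fin n → Bool

∣_∣ : ∀ {n} → VertexSet n → ℕ
∣_∣ {n} S = ∑[ x < n ] 𝟙 (S x)

allVertices : ∀ {n} → VertexSet n
allVertices _ = true

_∖_ : ∀ {n} → VertexSet n → Fin n → VertexSet n
(S ∖ u) x = S x ∧ not (does (u ≟ x))

∣allVertices∣ : ∀ n → ∣ allVertices {n} ∣ ≡ n
∣allVertices∣ zero    = refl
∣allVertices∣ (suc n) = cong suc (∣allVertices∣ n)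

∖⇒∈ : ∀ {n} (S : VertexSet n) u {x} → (S ∖ u) x ≡ true → S x ≡ true
∖⇒∈ S u = proj₁ ∘ ∧-true

∖⇒≢ : ∀ {n} (S : VertexSet n) u {x} → (S ∖ u) x ≡ true → u ≢ x
∖⇒≢ S u u∈S∖u refl rewrite dec-true (u ≟ u) refl = contradiction (trans (sym u∈S∖u) (∧-zeroʳ (S u))) λ ()

𝟙-∖ : ∀ {n} (S : VertexSet n) {u} → S u ≡ true → ∀ x → 𝟙 (S x) ≡ 𝟙 ((S ∖ u) x) + 𝟙 (does (u ≟ x))
𝟙-∖ S {u} Su x with u ≟ x
... | yes refl rewrite Su = refl
... | no _     = sym (trans (+-identityʳ _) (cong 𝟙 (∧-identityʳ (S x))))

∣∖∣ : ∀ {n} (S : VertexSet n) {u} → S u ≡ true → ∣ S ∣ ≡ suc ∣ S ∖ u ∣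
∣∖∣ {n} S {u} Su = begin
  ∣ S ∣                                           ≡⟨ sum-cong-≗ (𝟙-∖ S Su) ⟩
  ∑[ x < n ] (𝟙 ((S ∖ u) x) + 𝟙 (does (u ≟ x))) ≡⟨ ∑-distrib-+ {n} _ _ ⟩
  ∣ S ∖ u ∣ + ∑[ x < n ] 𝟙 (does (u ≟ x))        ≡⟨ cong (∣ S ∖ u ∣ +_) (∑-δ-count u) ⟩
  ∣ S ∖ u ∣ + 1                                   ≡⟨ +-comm _ 1 ⟩
  suc ∣ S ∖ u ∣                                   ∎
  where open ≡-Reasoning

adj⇒≢ : ∀ {n} (G : Graph n) {x y} → adj G x y ≡ true → x ≢ y
adj⇒≢ G {x} x-y refl = contradiction (trans (sym x-y) (adj-irrefl G x)) λ ()

module _ {n} (G : Graph n) where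
  open ≡-Reasoning

  deg : VertexSet n → Fin n → ℕ
  deg S x = ∑[ y < n ] (𝟙 (S y) * 𝟙 (adj G x y))

  degSum : VertexSet n → ℕ
  degSum S = ∑[ x < n ] (𝟙 (S x) * deg S x)

  deg-∖ : ∀ S {u} → S u ≡ true → ∀ x → deg S x ≡ deg (S ∖ u) x + 𝟙 (adj G x u)
  deg-∖ S {u} Su x = begin
    deg S x
      ≡⟨ sum-cong-≗ {n} (λ y → trans (cong (_* a y) (𝟙-∖ S Su y)) (*-distribʳ-+ (a y) (𝟙 ((S ∖ u) y)) _)) ⟩
    ∑[ y < n ] (𝟙 ((S ∖ u) y) * a y + 𝟙 (does (u ≟ y)) * a y)
      ≡⟨ ∑-distrib-+ {n} _ _ ⟩
    deg (S ∖ u) x + ∑[ y < n ] (𝟙 (does (u ≟ y)) * a y)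
      ≡⟨ cong (deg (S ∖ u) x +_) (∑-δ u a) ⟩
    deg (S ∖ u) x + 𝟙 (adj G x u) ∎
    where
    a : Fin n → ℕ
    a y = 𝟙 (adj G x y)

  deg-∖-self : ∀ S {u} → S u ≡ true → deg S u ≡ deg (S ∖ u) u
  deg-∖-self S {u} Su = begin
    deg S u                        ≡⟨ deg-∖ S Su u ⟩
    deg (S ∖ u) u + 𝟙 (adj G u u)  ≡⟨ cong (λ b → deg (S ∖ u) u + 𝟙 b) (adj-irrefl G u) ⟩
    deg (S ∖ u) u + 0              ≡⟨ +-identityʳ _ ⟩
    deg (S ∖ u) u                  ∎

  deg-∖-neighbour : ∀ S {u w} → S u ≡ true → adj G u w ≡ true → deg S w ≡ suc (deg (S ∖ u) w)
  deg-∖-neighbour S {u} {w} Su u-w = begin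
    deg S w                        ≡⟨ deg-∖ S Su w ⟩
    deg (S ∖ u) w + 𝟙 (adj G w u)  ≡⟨ cong (λ b → deg (S ∖ u) w + 𝟙 b) (trans (adj-sym G w u) u-w) ⟩
    deg (S ∖ u) w + 1              ≡⟨ +-comm _ 1 ⟩
    suc (deg (S ∖ u) w)            ∎

  degSum-∖ : ∀ S {u} → S u ≡ true → degSum S ≡ degSum (S ∖ u) + 2 * deg (S ∖ u) u
  degSum-∖ S {u} Su = begin
    degSum S
      ≡⟨ sum-cong-≗ {n} (λ x → cong₂ _*_ (𝟙-∖ S Su x) (deg-∖ S Su x)) ⟩
    ∑[ x < n ] ((s x + δ x) * (D x + a x))
      ≡⟨ sum-cong-≗ {n} (λ x → *-distribʳ-+ (D x + a x) (s x) (δ x)) ⟩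
    ∑[ x < n ] (s x * (D x + a x) + δ x * (D x + a x))
      ≡⟨ ∑-distrib-+ {n} _ _ ⟩
    ∑[ x < n ] (s x * (D x + a x)) + ∑[ x < n ] (δ x * (D x + a x))
      ≡⟨ cong₂ _+_ (trans (sum-cong-≗ {n} λ x → *-distribˡ-+ (s x) (D x) (a x)) (∑-distrib-+ {n} _ _))
                   (∑-δ u λ x → D x + a x) ⟩
    degSum (S ∖ u) + ∑[ x < n ] (s x * a x) + (D u + a u)
      ≡⟨ cong₂ (λ p q → degSum (S ∖ u) + p + (D u + 𝟙 q))
               (sum-cong-≗ {n} λ x → cong (λ b → s x * 𝟙 b) (adj-sym G x u)) (adj-irrefl G u) ⟩
    degSum (S ∖ u) + D u + (D u + 0)
      ≡⟨ +-assoc (degSum (S ∖ u)) _ _ ⟩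
    degSum (S ∖ u) + 2 * D u ∎
    where
    s δ D a : Fin n → ℕ
    s x = 𝟙 ((S ∖ u) x)
    δ x = 𝟙 (does (u ≟ x))
    D   = deg (S ∖ u)
    a x = 𝟙 (adj G x u)

  deg≤∣∣ : ∀ S x → deg S x ≤ ∣ S ∣
  deg≤∣∣ S x = ∑-mono-≤ λ y → ≤-trans (*-monoʳ-≤ (𝟙 (S y)) (𝟙≤1 _)) (≤-reflexive (*-identityʳ _))

  deg≤1 : ∀ S x p → (∀ y → S y ≡ true → adj G x y ≡ true → y ≡ p) → deg S x ≤ 1
  deg≤1 S x p only-p = ≤-trans (∑-mono-≤ term) (≤-reflexive (∑-δ-count p))
    where
    term : ∀ y → 𝟙 (S y) * 𝟙 (adj G x y) ≤ 𝟙 (does (p ≟ y))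
    term y with S y in Sy | adj G x y in x-y
    ... | false | _     = z≤n
    ... | true  | false = z≤n
    ... | true  | true  rewrite dec-true (p ≟ y) (sym (only-p y Sy x-y)) = ≤-refl

  deg-positive⇒neighbour : ∀ S x → 0 < deg S x → ∃ λ y → S y ≡ true × adj G x y ≡ true
  deg-positive⇒neighbour S x deg>0 with any? (λ y → S y Bool.≟ true ×-dec adj G x y Bool.≟ true)
  ... | yes found = found
  ... | no none   = contradiction (∑-zero term) (>⇒≢ deg>0)
    where
    term : ∀ y → 𝟙 (S y) * 𝟙 (adj G x y) ≡ 0
    term y with S y in Sy | adj G x y in x-y
    ... | false | _     = refl
    ... | true  | false = refl
    ... | true  | true  = contradiction (y , Sy , x-y) none

  degSum-isolated : ∀ S → (∀ x → S x ≡ true → deg S x ≡ 0) → degSum S ≡ 0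
  degSum-isolated S isolated = ∑-zero term
    where
    term : ∀ x → 𝟙 (S x) * deg S x ≡ 0
    term x with S x in Sx
    ... | false = refl
    ... | true  = trans (+-identityʳ _) (isolated x Sx)

-- Counting edges

module _ {n} (G : Graph n) where
  open ≡-Reasoning

  ordered : Fin n → Fin n → Bool
  ordered i j = (toℕ i <ᵇ toℕ j) ∧ adj G i j

  e≡∑ordered : e G ≡ ∑[ i < n ] ∑[ j < n ] 𝟙 (ordered i j)
  e≡∑ordered = begin
    e G                                        ≡⟨ cong (length ∘ filter P? ∘ concat) (map-tabulate id row) ⟩
    length (filter P? (concat (tabulate row))) ≡⟨ length-filter-concat-tabulate P? row ⟩
    ∑[ i < n ] length (filter P? (row i))      ≡⟨ sum-cong-≗ {n} count-row ⟩
    ∑[ i < n ] ∑[ j < n ] 𝟙 (ordered i j)      ∎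
    where
    P? : (p : Fin n × Fin n) → Dec (T (ordered (proj₁ p) (proj₂ p)))
    P? p = T? (ordered (proj₁ p) (proj₂ p))
    row : Fin n → List (Fin n × Fin n)
    row i = map (i ,_) (allFin n)
    count-row : ∀ i → length (filter P? (row i)) ≡ ∑[ j < n ] 𝟙 (ordered i j)
    count-row i = trans (cong (length ∘ filter P?) (map-tabulate id (i ,_))) (length-filter-tabulate P? (i ,_))

  𝟙-adj-ordered : ∀ x y → 𝟙 (adj G x y) ≡ 𝟙 (ordered x y) + 𝟙 (ordered y x)
  𝟙-adj-ordered x y with <-cmp (toℕ x) (toℕ y)
  ... | tri< x<y _ y≮x
    rewrite dec-true (toℕ x ℕ.<? toℕ y) x<y | dec-false (toℕ y ℕ.<? toℕ x) y≮x = sym (+-identityʳ _)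
  ... | tri> x≮y _ y<x
    rewrite dec-false (toℕ x ℕ.<? toℕ y) x≮y | dec-true (toℕ y ℕ.<? toℕ x) y<x = cong 𝟙 (adj-sym G x y)
  ... | tri≈ _ x≡y _ rewrite toℕ-injective x≡y | adj-irrefl G y | ∧-zeroʳ (toℕ y <ᵇ toℕ y) = refl

  e-via-orientation : (o : Fin n → Fin n → ℕ) → (∀ x y → 𝟙 (adj G x y) ≡ o x y + o y x) →
    e G ≡ ∑[ x < n ] ∑[ y < n ] o x y
  e-via-orientation o split = *-cancelˡ-≡ _ _ 2 (begin
    2 * e G                                    ≡⟨ cong (2 *_) e≡∑ordered ⟩
    2 * ∑[ x < n ] ∑[ y < n ] 𝟙 (ordered x y)  ≡⟨ ∑∑-symmetrise _ _ 𝟙-adj-ordered ⟨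
    ∑[ x < n ] ∑[ y < n ] 𝟙 (adj G x y)        ≡⟨ ∑∑-symmetrise _ o split ⟩
    2 * ∑[ x < n ] ∑[ y < n ] o x y            ∎)

  handshake : degSum G allVertices ≡ 2 * e G
  handshake = begin
    degSum G allVertices
      ≡⟨ sum-cong-≗ {n} (λ x → trans (+-identityʳ _) (sum-cong-≗ {n} λ y → +-identityʳ _)) ⟩
    ∑[ x < n ] ∑[ y < n ] 𝟙 (adj G x y)        ≡⟨ ∑∑-symmetrise _ _ 𝟙-adj-ordered ⟩
    2 * ∑[ x < n ] ∑[ y < n ] 𝟙 (ordered x y)  ≡⟨ cong (2 *_) e≡∑ordered ⟨
    2 * e G                                    ∎

-- Cycles and forests

module _ {n} {G : Graph n} (c : Cycle G) where
  open Cycle c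

  cycle-neighbours : ∀ i → ∃₂ λ p q → p ≢ q × adj G (v i) (v p) ≡ true × adj G (v i) (v q) ≡ true
  cycle-neighbours zero = fromℕ (suc (suc m)) , suc zero , (λ ()) , trans (adj-sym G _ _) close , step zero
  cycle-neighbours (suc j) with view j
  ... | ‵fromℕ      = inject₁ j , zero , (λ ()) , trans (adj-sym G _ _) (step j) , close
  ... | ‵inject₁ j′ = inject₁ (inject₁ j′) , suc (suc j′) , behind≢ahead
                    , trans (adj-sym G _ _) (step (inject₁ j′)) , step (suc j′)
    where
    open ≡-Reasoning
    behind≢ahead : inject₁ (inject₁ j′) ≢ suc (suc j′)
    behind≢ahead eq = m≢1+n+m (toℕ j′) {1} (begin
      toℕ j′                      ≡⟨ toℕ-inject₁ j′ ⟨
      toℕ (inject₁ j′)            ≡⟨ toℕ-inject₁ (inject₁ j′) ⟨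
      toℕ (inject₁ (inject₁ j′))  ≡⟨ cong toℕ eq ⟩
      suc (suc (toℕ j′))          ∎)

-- On a cycle, the vertex of largest rank has two distinct neighbours of no larger rank.
rank-forest : ∀ {n} (G : Graph n) (rank : Fin n → ℕ) →
  (∀ {x y z} → adj G x y ≡ true → adj G x z ≡ true → rank y ≤ rank x → rank z ≤ rank x → y ≡ z) →
  Forest G
rank-forest G rank one-lower c = no-two-lower (cycle-neighbours c top)
  where
  open Cycle c
  top : Fin (suc (suc (suc m)))
  top = Extrema.argmax (rank ∘ v) zero (allFin (suc (suc (suc m))))
  peak : ∀ j → rank (v j) ≤ rank (v top)
  peak j = All.lookup (Extrema.f[xs]≤f[argmax] {f = rank ∘ v} zero (allFin (suc (suc (suc m))))) (∈-allFin j)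
  no-two-lower : (∃₂ λ p q → p ≢ q × adj G (v top) (v p) ≡ true × adj G (v top) (v q) ≡ true) → ⊥
  no-two-lower (p , q , p≢q , top-p , top-q) = p≢q (inj (one-lower top-p top-q (peak p) (peak q)))

module _ {n} {G : Graph n} (w : ℕ → Fin n)
         (walk : ∀ t → adj G (w t) (w (suc t)) ≡ true)
         (no-backtrack : ∀ t → w (suc (suc t)) ≢ w t) where

  Revisit : ℕ → Set
  Revisit j = ∃ λ i → i < j × w i ≡ w j

  first-revisit : ∃ λ j → Revisit j × (∀ {j′} → j′ < j → ¬ Revisit j′)
  first-revisit with pigeonhole (n<1+n n) (w ∘ toℕ)
  ... | i , j , i<j , wi≡wj = least-witness (λ j → anyUpTo? (λ i → w i ≟ w j) j) (toℕ i , i<j , wi≡wj)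

  -- The first revisit closes a cycle, of length at least 3 since the walk neither stays put nor backtracks.
  walk⇒cycle : Cycle G
  walk⇒cycle with first-revisit
  ... | j , (i , i<j , wi≡wj) , first = close-up (j ∸ suc i) (sym (m+[n∸m]≡n i<j))
    where
    close-up : ∀ d → j ≡ suc i + d → Cycle G
    close-up zero refl = ⊥-elim (adj⇒≢ G (walk i) (trans wi≡wj (cong (w ∘ suc) (+-identityʳ i))))
    close-up (suc zero) refl = ⊥-elim (no-backtrack i (trans (cong (w ∘ suc) (+-comm 1 i)) (sym wi≡wj)))
    close-up (suc (suc m)) refl = record { m = m ; v = v ; inj = inj ; step = step ; close = close }
      where
      v : Fin (suc (suc (suc m))) → Fin n
      v t = w (i + toℕ t)
      distinct : ∀ {a b} → a < b → b < suc (suc (suc m)) → w (i + a) ≢ w (i + b)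
      distinct {a} {b} a<b b<3+m eq =
        first (subst (i + b <_) (+-suc i (suc (suc m))) (+-monoʳ-< i b<3+m)) (i + a , +-monoʳ-< i a<b , eq)
      inj : ∀ {s t} → v s ≡ v t → s ≡ t
      inj {s} {t} eq with <-cmp (toℕ s) (toℕ t)
      ... | tri< s<t _ _ = contradiction eq (distinct s<t (toℕ<n t))
      ... | tri≈ _ s≡t _ = toℕ-injective s≡t
      ... | tri> _ _ t<s = contradiction (sym eq) (distinct t<s (toℕ<n s))
      step : ∀ t → adj G (v (inject₁ t)) (v (suc t)) ≡ true
      step t rewrite toℕ-inject₁ t | +-suc i (toℕ t) = walk (i + toℕ t)
      close : adj G (v (fromℕ (suc (suc m)))) (v zero) ≡ true
      close rewrite toℕ-fromℕ (suc (suc m)) | +-identityʳ i | wi≡wj = walk (i + suc (suc m))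

module _ {n} (G : Graph n) (S : VertexSet n) (deg≥2 : ∀ x → S x ≡ true → 2 ≤ deg G S x) where

  another-neighbour : ∀ x → S x ≡ true → (p : Fin n) → ∃ λ y → S y ≡ true × adj G x y ≡ true × y ≢ p
  another-neighbour x Sx p with any? (λ y → S y Bool.≟ true ×-dec adj G x y Bool.≟ true ×-dec ¬? (y ≟ p))
  ... | yes found = found
  ... | no none   = contradiction (deg≤1 G S x p only-p) (<⇒≱ (deg≥2 x Sx))
    where
    only-p : ∀ y → S y ≡ true → adj G x y ≡ true → y ≡ p
    only-p y Sy x-y = decidable-stable (y ≟ p) λ y≢p → none (y , Sy , x-y , y≢p)

  record Arc : Set where
    field
      from to : Fin n
      to∈S    : S to ≡ true
      arc     : adj G from to ≡ true

  leave : ∀ x → S x ≡ true → Fin n → Arc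
  leave x Sx p = record { from = x ; to = proj₁ y ; to∈S = proj₁ (proj₂ y) ; arc = proj₁ (proj₂ (proj₂ y)) }
    where
    y : ∃ λ y → S y ≡ true × adj G x y ≡ true × y ≢ p
    y = another-neighbour x Sx p

  advance : Arc → Arc
  advance a = leave (Arc.to a) (Arc.to∈S a) (Arc.from a)

  advance-turns : ∀ a → Arc.to (advance a) ≢ Arc.from a
  advance-turns a = proj₂ (proj₂ (proj₂ (another-neighbour (Arc.to a) (Arc.to∈S a) (Arc.from a))))

  deg≥2⇒cycle : ∀ x → S x ≡ true → Cycle G
  deg≥2⇒cycle x Sx = walk⇒cycle (Arc.to ∘ arcs) (Arc.arc ∘ arcs ∘ suc) (advance-turns ∘ arcs ∘ suc)
    where
    arcs : ℕ → Arc
    arcs zero    = leave x Sx x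
    arcs (suc t) = advance (arcs t)

pred[s]+d≤s : ∀ {s d} → d ≤ 1 → d ≤ s → pred s + d ≤ s
pred[s]+d≤s {zero}  _   d≤0 = d≤0
pred[s]+d≤s {suc s} d≤1 _   = ≤-trans (+-monoʳ-≤ s d≤1) (≤-reflexive (+-comm s 1))

module _ {n} {F : Graph n} (acyclic : Forest F) where

  forest-degSum : ∀ s S → ∣ S ∣ ≡ s → degSum F S ≤ 2 * pred s
  forest-degSum s S ∣S∣≡s with any? (λ u → S u Bool.≟ true ×-dec deg F S u <? 2)
  forest-degSum zero    S ∣S∣≡0   | yes (u , Su , _) = contradiction (trans (sym ∣S∣≡0) (∣∖∣ S Su)) 0≢1+n
  forest-degSum (suc s) S ∣S∣≡1+s | yes (u , Su , deg<2) = begin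
    degSum F S                              ≡⟨ degSum-∖ F S Su ⟩
    degSum F (S ∖ u) + 2 * deg F (S ∖ u) u  ≤⟨ +-monoˡ-≤ _ (forest-degSum s (S ∖ u) ∣S∖u∣≡s) ⟩
    2 * pred s + 2 * deg F (S ∖ u) u        ≡⟨ *-distribˡ-+ 2 (pred s) _ ⟨
    2 * (pred s + deg F (S ∖ u) u)          ≤⟨ *-monoʳ-≤ 2 (pred[s]+d≤s leaf small) ⟩
    2 * s                                   ∎
    where
    open ≤-Reasoning
    ∣S∖u∣≡s : ∣ S ∖ u ∣ ≡ s
    ∣S∖u∣≡s = suc-injective (trans (sym (∣∖∣ S Su)) ∣S∣≡1+s)
    small : deg F (S ∖ u) u ≤ s
    small = subst (_ ≤_) ∣S∖u∣≡s (deg≤∣∣ F (S ∖ u) u)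
    leaf : deg F (S ∖ u) u ≤ 1
    leaf = subst (_≤ 1) (deg-∖-self F S Su) (s≤s⁻¹ deg<2)
  ... | no no-leaf with any? (λ x → S x Bool.≟ true)
  ...   | yes (x , Sx) =
    contradiction (deg≥2⇒cycle F S (λ y Sy → ≮⇒≥ λ d<2 → no-leaf (y , Sy , d<2)) x Sx) acyclic
  ...   | no empty     = ≤-trans (≤-reflexive (degSum-isolated F S λ x Sx → contradiction (x , Sx) empty)) z≤n

forest⇒e≤pred : ∀ {n} {F : Graph n} → Forest F → e F ≤ pred n
forest⇒e≤pred {n} {F} acyclic = *-cancelˡ-≤ 2 (begin
  2 * e F               ≡⟨ handshake F ⟨
  degSum F allVertices  ≤⟨ forest-degSum acyclic n allVertices (∣allVertices∣ n) ⟩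
  2 * pred n            ∎)
  where open ≤-Reasoning

-- Forests given by parent pointers

module _ {n} (G : Graph n) where

  -- A forest in G[S] given by parent pointers: its edges are the pairs {x, y} with parent x = just y.
  record RankedForest (S : VertexSet n) : Set where
    field
      parent      : Fin n → Maybe (Fin n)
      rank        : Fin n → ℕ
      parent-adj  : ∀ {x y} → parent x ≡ just y → adj G x y ≡ true
      parent-rank : ∀ {x y} → parent x ≡ just y → rank y < rank x
      parent-in   : ∀ {x y} → parent x ≡ just y → S x ≡ true × S y ≡ true

    hasParent : VertexSet n
    hasParent x = is-just (parent x)

    size : ℕ
    size = ∣ hasParent ∣

    pointsTo : Fin n → Fin n → Bool
    pointsTo x y = maybe (λ z → does (z ≟ y)) false (parent x)

    pointsTo⇒parent : ∀ {x y} → pointsTo x y ≡ true → parent x ≡ just y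
    pointsTo⇒parent {x} {y} x→y with parent x
    ... | just z = cong just (decidable-stable (z ≟ y) λ z≢y →
                     contradiction (trans (sym x→y) (dec-false (z ≟ y) z≢y)) λ ())

    not-both-ways : ∀ x y → ¬ (pointsTo x y ≡ true × pointsTo y x ≡ true)
    not-both-ways x y (x→y , y→x) =
      <-asym (parent-rank (pointsTo⇒parent x→y)) (parent-rank (pointsTo⇒parent y→x))

    no-self-loop : ∀ x → pointsTo x x ≡ false
    no-self-loop x with pointsTo x x in x→x
    ... | false = refl
    ... | true  = contradiction (parent-rank (pointsTo⇒parent x→x)) (<-irrefl refl)

    forestGraph : Graph n
    forestGraph = record
      { adj    = λ x y → pointsTo x y ∨ pointsTo y x
      ; sym    = λ x y → ∨-comm (pointsTo x y) (pointsTo y x)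
      ; irrefl = λ x → cong₂ _∨_ (no-self-loop x) (no-self-loop x)
      }

    forestGraph⊆G : forestGraph ⊆G G
    forestGraph⊆G x y _ with pointsTo x y in x→y | pointsTo y x in y→x
    ... | true  | _    = parent-adj (pointsTo⇒parent x→y)
    ... | false | true = trans (adj-sym G x y) (parent-adj (pointsTo⇒parent y→x))

    lower-neighbour-is-parent : ∀ {x y} → adj forestGraph x y ≡ true → rank y ≤ rank x → parent x ≡ just y
    lower-neighbour-is-parent {x} {y} _ ry≤rx with pointsTo x y in x→y | pointsTo y x in y→x
    ... | true  | _    = pointsTo⇒parent x→y
    ... | false | true = contradiction ry≤rx (<⇒≱ (parent-rank (pointsTo⇒parent y→x)))

    forestGraph-acyclic : Forest forestGraph
    forestGraph-acyclic = rank-forest forestGraph rank λ x-y x-z ry≤rx rz≤rx →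
      just-injective (trans (sym (lower-neighbour-is-parent x-y ry≤rx)) (lower-neighbour-is-parent x-z rz≤rx))

    ∑-pointsTo : ∀ x → ∑[ y < n ] 𝟙 (pointsTo x y) ≡ 𝟙 (hasParent x)
    ∑-pointsTo x with parent x
    ... | nothing = ∑-zero {n} λ _ → refl
    ... | just z  = ∑-δ-count z

    e-forestGraph : e forestGraph ≡ size
    e-forestGraph = begin
      e forestGraph
        ≡⟨ e-via-orientation forestGraph (λ x y → 𝟙 (pointsTo x y)) (λ x y → 𝟙-∨ (not-both-ways x y)) ⟩
      ∑[ x < n ] ∑[ y < n ] 𝟙 (pointsTo x y)
        ≡⟨ sum-cong-≗ {n} ∑-pointsTo ⟩
      size ∎
      where open ≡-Reasoning

  open RankedForest

  noParents : ∀ {S} → RankedForest S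
  noParents = record
    { parent = λ _ → nothing ; rank = λ _ → 0 ; parent-adj = λ () ; parent-rank = λ () ; parent-in = λ () }

  size-noParents : ∀ {S} → size (noParents {S}) ≡ 0
  size-noParents = ∑-zero {n} λ _ → refl

  module _ {S : VertexSet n} {u w : Fin n} (Su : S u ≡ true) (Sw : S w ≡ true) (u-w : adj G u w ≡ true) where

    attachLeaf : RankedForest (S ∖ u) → RankedForest S
    attachLeaf F = record
      { parent = parent′ ; rank = rank′ ; parent-adj = adj′ ; parent-rank = rank-ok ; parent-in = in′ }
      where
      parent′ : Fin n → Maybe (Fin n)
      parent′ x = if does (u ≟ x) then just w else parent F x
      rank′ : Fin n → ℕ
      rank′ x = if does (u ≟ x) then suc (rank F w) else rank F x
      rank′-off : ∀ {x} → u ≢ x → rank′ x ≡ rank F x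
      rank′-off {x} u≢x rewrite dec-false (u ≟ x) u≢x = refl
      adj′ : ∀ {x y} → parent′ x ≡ just y → adj G x y ≡ true
      adj′ {x} p with u ≟ x | p
      ... | yes refl | refl = u-w
      ... | no _     | p′   = parent-adj F p′
      rank-ok : ∀ {x y} → parent′ x ≡ just y → rank′ y < rank′ x
      rank-ok {x} p with u ≟ x | p
      ... | yes refl | refl = subst (_< suc (rank F w)) (sym (rank′-off (adj⇒≢ G u-w))) ≤-refl
      ... | no _     | p′   =
        subst (_< rank F x) (sym (rank′-off (∖⇒≢ S u (proj₂ (parent-in F p′))))) (parent-rank F p′)
      in′ : ∀ {x y} → parent′ x ≡ just y → S x ≡ true × S y ≡ true
      in′ {x} p with u ≟ x | p
      ... | yes refl | refl = Su , Sw
      ... | no _     | p′   = ∖⇒∈ S u (proj₁ (parent-in F p′)) , ∖⇒∈ S u (proj₂ (parent-in F p′))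

    size-attachLeaf : ∀ F → size (attachLeaf F) ≡ suc (size F)
    size-attachLeaf F =
      trans (∣∖∣ (hasParent (attachLeaf F)) u-hasParent) (cong suc (sum-cong-≗ {n} (cong 𝟙 ∘ same)))
      where
      u-hasParent : hasParent (attachLeaf F) u ≡ true
      u-hasParent rewrite dec-true (u ≟ u) refl = refl
      same : ∀ x → (hasParent (attachLeaf F) ∖ u) x ≡ hasParent F x
      same x with u ≟ x
      ... | no _ = ∧-identityʳ _
      ... | yes refl with parent F u in pu
      ...   | nothing = refl
      ...   | just _  = contradiction refl (∖⇒≢ S u (proj₁ (parent-in F pu)))

    module _ (triangle-free : TriangleFree G) where

      private
        nearStar farStar : VertexSet n
        nearStar x = S x ∧ adj G u x
        farStar  x = (S ∖ u) x ∧ adj G w x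

        starParent : Fin n → Maybe (Fin n)
        starParent x = if nearStar x then just u else if farStar x then just w else nothing

        starRank : Fin n → ℕ
        starRank x = if does (u ≟ x) then 0 else if adj G u x then 1 else 2

        rank-u : starRank u ≡ 0
        rank-u rewrite dec-true (u ≟ u) refl = refl

        rank-near : ∀ {x} → adj G u x ≡ true → starRank x ≡ 1
        rank-near {x} u-x rewrite dec-false (u ≟ x) (adj⇒≢ G u-x) | u-x = refl

        rank-far : ∀ {x} → (S ∖ u) x ≡ true → nearStar x ≡ false → starRank x ≡ 2
        rank-far {x} x∈S∖u ¬near rewrite dec-false (u ≟ x) (∖⇒≢ S u x∈S∖u)
          | subst (λ b → b ∧ adj G u x ≡ false) (∖⇒∈ S u x∈S∖u) ¬near = refl

        star-adj : ∀ {x y} → starParent x ≡ just y → adj G x y ≡ true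
        star-adj {x} p with nearStar x in near | farStar x in far | p
        ... | true  | _    | refl = trans (adj-sym G x u) (proj₂ (∧-true near))
        ... | false | true | refl = trans (adj-sym G x w) (proj₂ (∧-true far))

        star-rank : ∀ {x y} → starParent x ≡ just y → starRank y < starRank x
        star-rank {x} p with nearStar x in near | farStar x in far | p
        ... | true  | _    | refl = subst₂ _<_ (sym rank-u) (sym (rank-near (proj₂ (∧-true near)))) (s≤s z≤n)
        ... | false | true | refl =
          subst₂ _<_ (sym (rank-near u-w)) (sym (rank-far (proj₁ (∧-true far)) near)) (s≤s (s≤s z≤n))

        star-in : ∀ {x y} → starParent x ≡ just y → S x ≡ true × S y ≡ true
        star-in {x} p with nearStar x in near | farStar x in far | p
        ... | true  | _    | refl = proj₁ (∧-true near) , Su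
        ... | false | true | refl = ∖⇒∈ S u (proj₁ (∧-true far)) , Sw

        𝟙-starParent : ∀ x → 𝟙 (is-just (starParent x)) ≡ 𝟙 (nearStar x) + 𝟙 (farStar x)
        𝟙-starParent x with nearStar x in near | farStar x in far
        ... | false | false = refl
        ... | false | true  = refl
        ... | true  | false = refl
        ... | true  | true  = ⊥-elim (triangle-free (u , w , x , u-w , proj₂ (∧-true far) , proj₂ (∧-true near)))

      doubleStar : RankedForest S
      doubleStar = record
        { parent = starParent ; rank = starRank ; parent-adj = star-adj ; parent-rank = star-rank ; parent-in = star-in }

      size-doubleStar : size doubleStar ≡ deg G S u + deg G (S ∖ u) w
      size-doubleStar = begin
        size doubleStar                                       ≡⟨ sum-cong-≗ {n} 𝟙-starParent ⟩
        ∑[ x < n ] (𝟙 (nearStar x) + 𝟙 (farStar x))           ≡⟨ ∑-distrib-+ {n} _ _ ⟩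
        ∑[ x < n ] 𝟙 (nearStar x) + ∑[ x < n ] 𝟙 (farStar x)  ≡⟨ cong₂ _+_ (sum-cong-≗ {n} λ x → 𝟙-∧ (S x) _)
                                                                          (sum-cong-≗ {n} λ x → 𝟙-∧ ((S ∖ u) x) _) ⟩
        deg G S u + deg G (S ∖ u) w                           ∎
        where open ≡-Reasoning

-- The greedy forest

2x≤2y+1⇒x≤y : ∀ {x y} → 2 * x ≤ 2 * y + 1 → x ≤ y
2x≤2y+1⇒x≤y {x} {y} 2x≤2y+1 =
  s≤s⁻¹ (*-cancelˡ-< 2 x (suc y) (≤-trans (s≤s 2x≤2y+1) (≤-reflexive (double y))))
  where
  double : ∀ y → suc (2 * y + 1) ≡ 2 * suc y
  double = solve-∀

leaf-bound : ∀ X d f → 2 * X ≤ suc f * suc f → 4 * d ≤ 2 * f + 3 →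
  2 * (X + 2 * d) ≤ suc (suc f) * suc (suc f)
leaf-bound X d f bound few = begin
  2 * (X + 2 * d)              ≡⟨ expand X d ⟩
  2 * X + 4 * d                ≤⟨ +-mono-≤ bound few ⟩
  suc f * suc f + (2 * f + 3)  ≡⟨ square f ⟩
  suc (suc f) * suc (suc f)    ∎
  where
  open ≤-Reasoning
  expand : ∀ X d → 2 * (X + 2 * d) ≡ 2 * X + 4 * d
  expand = solve-∀
  square : ∀ f → suc f * suc f + (2 * f + 3) ≡ suc (suc f) * suc (suc f)
  square = solve-∀

star-bound : ∀ X d f g → 2 * X ≤ suc f * suc f → 2 * f + 3 < 4 * d → d ≤ suc g →
  2 * (X + 2 * d) ≤ suc (d + g) * suc (d + g)
star-bound X (suc d) f g bound many d≤1+g = begin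
  2 * (X + 2 * suc d)                    ≡⟨ expand X d ⟩
  2 * X + 4 * suc d                      ≤⟨ +-monoˡ-≤ (4 * suc d) (*-monoʳ-≤ 2 X≤) ⟩
  2 * (2 * (d * d) + 2 * d) + 4 * suc d  ≡⟨ square d ⟩
  (suc d + suc d) * (suc d + suc d)      ≤⟨ *-mono-≤ 2d≤ 2d≤ ⟩
  suc (suc d + g) * suc (suc d + g)      ∎
  where
  open ≤-Reasoning
  expand : ∀ X d → 2 * (X + 2 * suc d) ≡ 2 * X + 4 * suc d
  expand = solve-∀
  square : ∀ d → 2 * (2 * (d * d) + 2 * d) + 4 * suc d ≡ (suc d + suc d) * (suc d + suc d)
  square = solve-∀
  odd-square : ∀ d → suc (2 * d) * suc (2 * d) ≡ 2 * (2 * (d * d) + 2 * d) + 1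
  odd-square = solve-∀
  f≤2d : f ≤ 2 * d
  f≤2d = *-cancelˡ-≤ 2 (+-cancelʳ-≤ 4 (2 * f) (2 * (2 * d)) (subst₂ _≤_ (lhs f) (rhs d) many))
    where
    lhs : ∀ f → suc (2 * f + 3) ≡ 2 * f + 4
    lhs = solve-∀
    rhs : ∀ d → 4 * suc d ≡ 2 * (2 * d) + 4
    rhs = solve-∀
  -- 2X ≤ (f + 1)² ≤ (2d + 1)² is odd, so X ≤ 2d² + 2d.
  X≤ : X ≤ 2 * (d * d) + 2 * d
  X≤ = 2x≤2y+1⇒x≤y (≤-trans bound (≤-trans (*-mono-≤ (s≤s f≤2d) (s≤s f≤2d)) (≤-reflexive (odd-square d))))
  2d≤ : suc d + suc d ≤ suc (suc d + g)
  2d≤ = ≤-trans (+-monoʳ-≤ (suc d) d≤1+g) (≤-reflexive (+-suc (suc d) g))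

module _ {n} (G : Graph n) (triangle-free : TriangleFree G) where
  open RankedForest

  -- degSum G S = 2 e(G[S]), so the bound reads 4 e(G[S]) ≤ (size F + 1)².
  DenseForest : VertexSet n → Set
  DenseForest S = Σ (RankedForest G S) λ F → 2 * degSum G S ≤ suc (size F) * suc (size F)

  Active : VertexSet n → Fin n → Set
  Active S x = S x ≡ true × 0 < deg G S x

  active? : ∀ S → Decidable (Active S)
  active? S x = S x Bool.≟ true ×-dec 0 <? deg G S x

  least-active : ∀ S → ∃ (Active S) → ∃ λ u → Active S u × (∀ x → Active S x → deg G S u ≤ deg G S x)
  least-active S (u₀ , u₀-active) =
    u , Extrema.argmin-all (deg G S) u₀-active (all-filter (active? S) (allFin n)) , least
    where
    candidates : List (Fin n)
    candidates = filter (active? S) (allFin n)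
    u : Fin n
    u = Extrema.argmin (deg G S) u₀ candidates
    least : ∀ x → Active S x → deg G S u ≤ deg G S x
    least x x-active = All.lookup (Extrema.f[argmin]≤f[xs] {f = deg G S} u₀ candidates)
                                  (∈-filter⁺ (active? S) (∈-allFin x) x-active)

  extend : ∀ {S u w} → S u ≡ true → S w ≡ true → adj G u w ≡ true → deg G S u ≤ deg G S w →
    DenseForest (S ∖ u) → DenseForest S
  extend {S} {u} {w} Su Sw u-w u≤w (F , bound) = choose (4 * deg G S u ≤? 2 * size F + 3)
    where
    degSum≡ : degSum G S ≡ degSum G (S ∖ u) + 2 * deg G S u
    degSum≡ = trans (degSum-∖ G S Su) (cong (λ d → degSum G (S ∖ u) + 2 * d) (sym (deg-∖-self G S Su)))
    choose : Dec (4 * deg G S u ≤ 2 * size F + 3) → DenseForest S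
    choose (yes few) = attachLeaf G Su Sw u-w F
      , subst₂ (λ D s → 2 * D ≤ suc s * suc s) (sym degSum≡) (sym (size-attachLeaf G Su Sw u-w F))
               (leaf-bound (degSum G (S ∖ u)) (deg G S u) (size F) bound few)
    choose (no many) = doubleStar G Su Sw u-w triangle-free
      , subst₂ (λ D s → 2 * D ≤ suc s * suc s) (sym degSum≡) (sym (size-doubleStar G Su Sw u-w triangle-free))
               (star-bound (degSum G (S ∖ u)) (deg G S u) (size F) (deg G (S ∖ u) w) bound (≰⇒> many)
                           (subst (deg G S u ≤_) (deg-∖-neighbour G S Su u-w) u≤w))

  dense-forest : ∀ s S → ∣ S ∣ ≡ s → DenseForest S
  dense-forest s S ∣S∣≡s with any? (active? S)
  ... | no none = noParents G , subst₂ (λ D s → 2 * D ≤ suc s * suc s) (sym degSum≡0) (sym (size-noParents G {S})) z≤n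
    where
    degSum≡0 : degSum G S ≡ 0
    degSum≡0 = degSum-isolated G S λ x Sx → n≤0⇒n≡0 (≮⇒≥ λ deg>0 → none (x , Sx , deg>0))
  dense-forest zero    S ∣S∣≡0   | yes (u , Su , _) = contradiction (trans (sym ∣S∣≡0) (∣∖∣ S Su)) 0≢1+n
  dense-forest (suc s) S ∣S∣≡1+s | yes some-active with least-active S some-active
  ... | u , (Su , deg>0) , least with deg-positive⇒neighbour G S u deg>0
  ...   | w , Sw , u-w = extend Su Sw u-w (least w (Sw , w-active)) (dense-forest s (S ∖ u) ∣S∖u∣≡s)
    where
    ∣S∖u∣≡s : ∣ S ∖ u ∣ ≡ s
    ∣S∖u∣≡s = suc-injective (trans (sym (∣∖∣ S Su)) ∣S∣≡1+s)
    w-active : 0 < deg G S w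
    w-active = subst (0 <_) (sym (deg-∖-neighbour G S Su u-w)) z<s

quarter-bound : ∀ {E k f} → 4 * E ≤ suc f * suc f → (k * k) / 4 < E → k ≤ f
quarter-bound {E} {k} {f} 4E≤ k²/4<E with k ≤? f
... | yes k≤f = k≤f
... | no  k≰f = contradiction (begin
    E           ≡⟨ m*n/n≡m E 4 ⟨
    E * 4 / 4   ≤⟨ /-monoˡ-≤ 4 (begin
      E * 4          ≡⟨ *-comm E 4 ⟩
      4 * E          ≤⟨ 4E≤ ⟩
      suc f * suc f  ≤⟨ *-mono-≤ (≰⇒> k≰f) (≰⇒> k≰f) ⟩
      k * k          ∎) ⟩
    k * k / 4   ∎) (<⇒≱ k²/4<E)
  where open ≤-Reasoning

triangle-free⇒forest : ∀ {n} (G : Graph n) → TriangleFree G → (k : ℕ) → (k * k) / 4 < e G →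
  Σ (Graph n) λ F → F ⊆G G × Forest F × k ≤ e F
triangle-free⇒forest {n} G triangle-free k k²/4<e
  with dense-forest G triangle-free n allVertices (∣allVertices∣ n)
... | F , bound = forestGraph , forestGraph⊆G , forestGraph-acyclic
                , subst (k ≤_) (sym e-forestGraph) (quarter-bound 4e≤ k²/4<e)
  where
  open RankedForest F
  4e≤ : 4 * e G ≤ suc size * suc size
  4e≤ = subst (_≤ suc size * suc size) (trans (cong (2 *_) (handshake G)) (sym (*-assoc 2 2 (e G)))) bound

-- Complete bipartite graphs

∑-left : ∀ a b → ∑[ x < a + b ] 𝟙 (toℕ x <ᵇ a) ≡ a
∑-left zero    b = ∑-zero {b} λ _ → refl
∑-left (suc a) b = cong suc (∑-left a b)

∑-right : ∀ a b → ∑[ x < a + b ] 𝟙 (not (toℕ x <ᵇ a)) ≡ b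
∑-right zero    b = ∣allVertices∣ b
∑-right (suc a) b = ∑-right a b

module _ (a b : ℕ) where

  left : Fin (a + b) → Bool
  left x = toℕ x <ᵇ a

  K-triangle-free : TriangleFree (K a b)
  K-triangle-free (x , y , z , x-y , y-z , x-z) =
    contradiction (trans (sym x-z) (xor-triangle (left x) (left y) (left z) x-y y-z)) λ ()

  e-K : e (K a b) ≡ a * b
  e-K = begin
    e (K a b)
      ≡⟨ e-via-orientation (K a b) (λ x y → 𝟙 (left x ∧ not (left y))) (λ x y → 𝟙-xor (left x) (left y)) ⟩
    ∑[ x < a + b ] ∑[ y < a + b ] 𝟙 (left x ∧ not (left y))
      ≡⟨ sum-cong-≗ {a + b} (λ x → trans (sum-cong-≗ {a + b} λ y → 𝟙-∧ (left x) (not (left y)))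
                                         (sym (*-distribˡ-sum (𝟙 (left x)) λ y → 𝟙 (not (left y))))) ⟩
    ∑[ x < a + b ] (𝟙 (left x) * ∑[ y < a + b ] 𝟙 (not (left y)))
      ≡⟨ *-distribʳ-sum (∑[ y < a + b ] 𝟙 (not (left y))) (𝟙 ∘ left) ⟨
    ∑[ x < a + b ] 𝟙 (left x) * ∑[ y < a + b ] 𝟙 (not (left y))
      ≡⟨ cong₂ _*_ (∑-left a b) (∑-right a b) ⟩
    a * b ∎
    where open ≡-Reasoning

⌊k/2⌋*⌈k/2⌉≡k²/4 : ∀ k → ⌊ k /2⌋ * ⌈ k /2⌉ ≡ (k * k) / 4
⌊k/2⌋*⌈k/2⌉≡k²/4 zero          = refl
⌊k/2⌋*⌈k/2⌉≡k²/4 (suc zero)    = refl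
⌊k/2⌋*⌈k/2⌉≡k²/4 (suc (suc k)) = begin
  suc ⌊ k /2⌋ * suc ⌈ k /2⌉                   ≡⟨ expand ⌊ k /2⌋ ⌈ k /2⌉ ⟩
  ⌊ k /2⌋ * ⌈ k /2⌉ + suc (⌊ k /2⌋ + ⌈ k /2⌉)  ≡⟨ cong₂ (λ p s → p + suc s) (⌊k/2⌋*⌈k/2⌉≡k²/4 k) (⌊n/2⌋+⌈n/2⌉≡n k) ⟩
  (k * k) / 4 + suc k                          ≡⟨ cong ((k * k) / 4 +_) (m*n/n≡m (suc k) 4) ⟨
  (k * k) / 4 + (suc k * 4) / 4                ≡⟨ +-distrib-/-∣ʳ (k * k) (divides (suc k) refl) ⟨
  (k * k + suc k * 4) / 4                      ≡⟨ cong (_/ 4) (square k) ⟩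
  (suc (suc k) * suc (suc k)) / 4              ∎
  where
  open ≡-Reasoning
  expand : ∀ a c → suc a * suc c ≡ a * c + suc (a + c)
  expand = solve-∀
  square : ∀ k → k * k + suc k * 4 ≡ suc (suc k) * suc (suc k)
  square = solve-∀

lemma5p1 : (k : ℕ) → 1 ≤ k →
    ((n : ℕ) (G : Graph n) → TriangleFree G → (k * k) / 4 < e G →
      Σ (Graph n) λ F → F ⊆G G × Forest F × k ≤ e F)
    × (TriangleFree (K ⌊ k /2⌋ ⌈ k /2⌉)
       × e (K ⌊ k /2⌋ ⌈ k /2⌉) ≡ (k * k) / 4
       × ((F : Graph (⌊ k /2⌋ + ⌈ k /2⌉)) → F ⊆G K ⌊ k /2⌋ ⌈ k /2⌉ → Forest F → e F < k))
lemma5p1 k k≥1 =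
    (λ n G triangle-free k²/4<e → triangle-free⇒forest G triangle-free k k²/4<e)
  , K-triangle-free ⌊ k /2⌋ ⌈ k /2⌉
  , trans (e-K ⌊ k /2⌋ ⌈ k /2⌉) (⌊k/2⌋*⌈k/2⌉≡k²/4 k)
  , λ F _ acyclic → m≤pred[n]⇒suc[m]≤n {{>-nonZero k≥1}}
                      (subst (λ m → e F ≤ pred m) (⌊n/2⌋+⌈n/2⌉≡n k) (forest⇒e≤pred acyclic))
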